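{- Let $\Sigma$ be an effect signature, $Q$ a complete lattice and $\mathcal{Q}$ a set of modalities on $Q$, all of which are leaf-monotone. Then the relator $\mathcal{Q}(-)$ satisfies: (1) if $R\subseteq X\times X$ is reflexive, then so is $\mathcal{Q}(R)$; (2) if $R\subseteq S\subseteq X\times Y$, then $\mathcal{Q}(R)\subseteq\mathcal{Q}(S)$; (3) for $R\subseteq X\times Y$ and $S\subseteq Y\times Z$, $\mathcal{Q}(R)\,\mathcal{Q}(S)\subseteq\mathcal{Q}(RS)$, where juxtaposition denotes relational composition; (4) for all $f:X\to Z$, $g:Y\to W$ and $R\subseteq Z\times W$, $\mathcal{Q}((f\times g)^{ -1}R)=(f^*\times g^*)^{ -1}\mathcal{Q}(R)$, where $(f\times g)^{ -1}R=\{(x,y)\in X\times Y\mid f(x)\,R\,g(y)\}$ and similarly $(f^*\times g^*)^{ -1}\mathcal{Q}(R)=\{(t,r)\in TX\times TY\mid f^*(t)\,\mathcal{Q}(R)\,g^*(r)\}$.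
   Context: Effect signature: a set $\Sigma$ of operation symbols, each with an arity of one of the forms $\alpha^n\to\alpha$ ($n\in\mathbb{N}$), $\mathbb{N}\times\alpha^n\to\alpha$, or $\alpha^{\mathbb{N}}\to\alpha$. For a set $X$, $TX$ is the set of effect trees over $X$: labelled, possibly infinite-depth trees whose nodes are either a leaf labelled $\bot$, a leaf labelled by some $x\in X$, a node labelled $\sigma$ with children $t_1,\dots,t_n$ (for $\sigma:\alpha^n\to\alpha$), a node labelled $\sigma$ with children $t_0,t_1,\dots$ (for $\sigma:\alpha^{\mathbb{N}}\to\alpha$), or a node labelled $\sigma_m$ ($m\in\mathbb{N}$) with children $t_1,\dots,t_n$ (for $\sigma:\mathbb{N}\times\alpha^n\to\alpha$). For $h:X\to Y$, $h^*:TX\to TY$ replaces every non-$\bot$ leaf $x$ by $h(x)$. $Q$ is a complete lattice with order $\le$. A modality $q$ is a function $[\![q]\!]:TQ\to Q$; for $h:X\to Q$ and $t\in TX$ write $(t\in q(h)) := [\![q]\!](h^*(t))$. Leaf order on $TQ$: $t\,T(\le)\,r$ iff $r$ is obtained from $t$ by replacing each leaf labelled $a\in Q$ by a leaf labelled some $b\ge a$ ($\bot$ leaves and internal nodes unchanged). $q$ is leaf-monotone if $t\,T(\le)\,r$ implies $[\![q]\!](t)\le[\![q]\!](r)$. For $R\subseteq X\times Y$ and $h:X\to Q$, $(R{\upharpoonright}h)(y):=\sup\{h(x)\mid x\in X,\ xRy\}$. The relator: for $R\subseteq X\times Y$, $\mathcal{Q}(R)\subseteq TX\times TY$ is defined by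 $t\,\mathcal{Q}(R)\,r$ iff for all $q\in\mathcal{Q}$ and all $h:X\to Q$, $(t\in q(h))\le(r\in q(R{\upharpoonright}h))$. -}

module Defs where

open import Level using (Level; _⊔_) renaming (suc to lsuc; zero to lzero)
open import Data.Nat using (ℕ; _<_)
open import Data.Unit using (⊤)
open import Data.Empty using (⊥)
open import Data.List using (List; []; _∷ʳ_)
open import Data.Product using (Σ; _,_; proj₁; proj₂; ∃; _×_)
open import Function.Bundles using (_⇔_; mk⇔; module Equivalence)
open import Relation.Nullary using (¬_)
open import Relation.Binary.PropositionalEquality using (_≡_; refl)
open import Relation.Binary.Structures using (IsPartialOrder)
open import Relation.Binary.Core using (REL; _⇒_)
open import Relation.Binary.Definitions using (Reflexive)

-- The three kinds of arities:  α^n → α ,  ℕ × α^n → α ,  α^ℕ → α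
data Arity : Set where
  fin    : ℕ → Arity
  natFin : ℕ → Arity
  omega  : Arity

-- the extra parameter carried by a node (the m in σ_m for ℕ × α^n → α)
Param : Arity → Set
Param (fin n)    = ⊤
Param (natFin n) = ℕ
Param omega      = ⊤

ValidIx : Arity → ℕ → Set
ValidIx (fin n)    i = i < n
ValidIx (natFin n) i = i < n
ValidIx omega      i = ⊤

record Signature : Set₁ where
  field
    Op : Set
    ar : Op → Arity
open Signature public

-- Effect trees (possibly infinite depth), represented by their node
-- labelling on paths (list of child indices from the root).
-- 'none' marks paths that do not exist in the tree.

module Trees (Sig : Signature) where

  data Label (X : Set) : Set where
    none : Label X
    bot  : Label X
    leaf : X → Label X
    node : (σ : Op Sig) → Param (ar Sig σ) → Label X

  ValidChild : {X : Set} → Label X → ℕ → Set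
  ValidChild none       i = ⊥
  ValidChild bot        i = ⊥
  ValidChild (leaf x)   i = ⊥
  ValidChild (node σ m) i = ValidIx (ar Sig σ) i

  Path : Set
  Path = List ℕ

  record WellFormed {X : Set} (f : Path → Label X) : Set where
    field
      root-exists : ¬ (f [] ≡ none)
      child-exists : ∀ ps i → (¬ (f (ps ∷ʳ i) ≡ none)) ⇔ ValidChild (f ps) i

  T : Set → Set
  T X = Σ (Path → Label X) WellFormed

  mapLabel : {X Y : Set} → (X → Y) → Label X → Label Y
  mapLabel h none       = none
  mapLabel h bot        = bot
  mapLabel h (leaf x)   = leaf (h x)
  mapLabel h (node σ m) = node σ m

  private
    mapLabel-none→ : {X Y : Set} (h : X → Y) (l : Label X) → mapLabel h l ≡ none → l ≡ none
    mapLabel-none→ h none eq = refl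
    mapLabel-none→ h bot ()
    mapLabel-none→ h (leaf x) ()
    mapLabel-none→ h (node σ m) ()

    mapLabel-none← : {X Y : Set} (h : X → Y) (l : Label X) → l ≡ none → mapLabel h l ≡ none
    mapLabel-none← h .none refl = refl

    valid→ : {X Y : Set} (h : X → Y) (l : Label X) (i : ℕ) → ValidChild l i → ValidChild (mapLabel h l) i
    valid→ h (node σ m) i v = v

    valid← : {X Y : Set} (h : X → Y) (l : Label X) (i : ℕ) → ValidChild (mapLabel h l) i → ValidChild l i
    valid← h (node σ m) i v = v

  _* : {X Y : Set} → (X → Y) → T X → T Y
  (h *) (f , wf) =
    (λ ps → mapLabel h (f ps)) ,
    record
      { root-exists = λ eq → WellFormed.root-exists wf (mapLabel-none→ h (f []) eq)
      ; child-exists = λ ps i → mk⇔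
          (λ ne → valid→ h (f ps) i
                    (Equivalence.to (WellFormed.child-exists wf ps i)
                      (λ eq → ne (mapLabel-none← h (f (ps ∷ʳ i)) eq))))
          (λ v eq → Equivalence.from (WellFormed.child-exists wf ps i) (valid← h (f ps) i v)
                      (mapLabel-none→ h (f (ps ∷ʳ i)) eq))
      }

record CompleteLattice (ℓ : Level) : Set (lsuc (lsuc lzero ⊔ ℓ)) where
  field
    Carrier        : Set
    _≤_            : Carrier → Carrier → Set ℓ
    isPartialOrder : IsPartialOrder _≡_ _≤_
    ⨆              : {I : Set} → (I → Carrier) → Carrier
    ⨆-upper        : {I : Set} (g : I → Carrier) (i : I) → g i ≤ ⨆ g
    ⨆-least        : {I : Set} (g : I → Carrier) (b : Carrier) →
                     (∀ i → g i ≤ b) → ⨆ g ≤ b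

module Relator {ℓ : Level} (Sig : Signature) (L : CompleteLattice ℓ) where
  open Trees Sig public
  open CompleteLattice L

  Q : Set
  Q = Carrier

  Modality : Set
  Modality = T Q → Q

  _∈_⟨_⟩ : {X : Set} → T X → Modality → (X → Q) → Q
  t ∈ q ⟨ h ⟩ = q ((h *) t)

  data LabelLeq : Label Q → Label Q → Set ℓ where
    none : LabelLeq none none
    bot  : LabelLeq bot bot
    leaf : ∀ {a b} → a ≤ b → LabelLeq (leaf a) (leaf b)
    node : ∀ σ m → LabelLeq (node σ m) (node σ m)

  _T≤_ : T Q → T Q → Set ℓ
  t T≤ r = ∀ ps → LabelLeq (proj₁ t ps) (proj₁ r ps)

  LeafMonotone : Modality → Set ℓ
  LeafMonotone q = ∀ {t r} → t T≤ r → q t ≤ q r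

  _↾_ : {X Y : Set} → REL X Y lzero → (X → Q) → Y → Q
  (R ↾ h) y = ⨆ {I = ∃ λ x → R x y} (λ p → h (proj₁ p))

  Rel𝒬 : {I : Set} (mods : I → Modality) {X Y : Set} →
         REL X Y lzero → REL (T X) (T Y) ℓ
  Rel𝒬 mods {X} R t r = ∀ (q : _) (h : X → Q) → (t ∈ mods q ⟨ h ⟩) ≤ (r ∈ mods q ⟨ R ↾ h ⟩)

preimage : {A B X Y : Set} {ℓ : Level} → (A → X) → (B → Y) → REL X Y ℓ → REL A B ℓ
preimage f g R a b = R (f a) (g b)

_⨾_ : {A B C : Set} {ℓ₁ ℓ₂ : Level} → REL A B ℓ₁ → REL B C ℓ₂ → REL A C (ℓ₁ ⊔ ℓ₂)
R ⨾ S = λ a c → ∃ λ b → R a b × S b c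

-- Leaf-monotonicity makes t ∈ q⟨h⟩ monotone in h, and it makes (f *) t ∈ q⟨h⟩
-- and t ∈ q⟨h ∘ f⟩ equal, since the two trees have the same labels.  With these
-- two facts each property of the relator reduces to a pointwise inequality between
-- sups R ↾ h; for the converse inclusion of (4) one tests with the image
-- weight z ↦ sup { h x | f x ≡ z }, which dominates h along f.
module Submission where

open import Defs
open import Level using (Level; 0ℓ)
open import Function using (_∘_)
open import Data.Product using (_×_; _,_; proj₁)
open import Relation.Binary.Bundles using (Poset)
open import Relation.Binary.Core using (REL; _⇒_)
open import Relation.Binary.Definitions using (Reflexive)
open import Relation.Binary.PropositionalEquality using (_≡_; refl; sym; subst)
import Relation.Binary.Reasoning.PartialOrder as PartialOrderReasoning

module LeafMonotoneRelator {ℓ : Level} (Sig : Signature) (L : CompleteLattice ℓ) where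
  open Relator Sig L
  open CompleteLattice L

  poset : Poset 0ℓ 0ℓ ℓ
  poset = record { isPartialOrder = isPartialOrder }

  open Poset poset using () renaming (refl to ≤-refl; trans to ≤-trans)
  open PartialOrderReasoning poset

  LabelLeq-reflexive : {l l′ : Label Q} → l ≡ l′ → LabelLeq l l′
  LabelLeq-reflexive {none}     refl = none
  LabelLeq-reflexive {bot}      refl = bot
  LabelLeq-reflexive {leaf a}   refl = leaf ≤-refl
  LabelLeq-reflexive {node σ m} refl = node σ m

  mapLabel-∘ : {X Y : Set} (f : X → Y) (h : Y → Q) (l : Label X) →
               mapLabel h (mapLabel f l) ≡ mapLabel (h ∘ f) l
  mapLabel-∘ f h none       = refl
  mapLabel-∘ f h bot        = refl
  mapLabel-∘ f h (leaf x)   = refl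
  mapLabel-∘ f h (node σ m) = refl

  mapLabel-mono : {X : Set} {h₁ h₂ : X → Q} → (∀ x → h₁ x ≤ h₂ x) →
                  (l : Label X) → LabelLeq (mapLabel h₁ l) (mapLabel h₂ l)
  mapLabel-mono h₁≤h₂ none       = none
  mapLabel-mono h₁≤h₂ bot        = bot
  mapLabel-mono h₁≤h₂ (leaf x)   = leaf (h₁≤h₂ x)
  mapLabel-mono h₁≤h₂ (node σ m) = node σ m

  ↾-upper : {X Y : Set} (R : REL X Y 0ℓ) {h : X → Q} {x : X} {y : Y} →
            R x y → h x ≤ (R ↾ h) y
  ↾-upper R {x = x} xRy = ⨆-upper _ (x , xRy)

  ↾-least : {X Y : Set} (R : REL X Y 0ℓ) {h : X → Q} {y : Y} {b : Q} →
            (∀ {x} → R x y → h x ≤ b) → (R ↾ h) y ≤ b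
  ↾-least R bound = ⨆-least _ _ (λ (_ , xRy) → bound xRy)

  ↾-mono : {X Y : Set} (R S : REL X Y 0ℓ) {h : X → Q} {y : Y} →
           R ⇒ S → (R ↾ h) y ≤ (S ↾ h) y
  ↾-mono R S R⇒S = ↾-least R (↾-upper S ∘ R⇒S)

  ↾-⨾ : {X Y Z : Set} (R : REL X Y 0ℓ) (S : REL Y Z 0ℓ) {h : X → Q} {z : Z} →
        (S ↾ (R ↾ h)) z ≤ ((R ⨾ S) ↾ h) z
  ↾-⨾ R S = ↾-least S λ ySz → ↾-least R λ xRy → ↾-upper (R ⨾ S) (_ , xRy , ySz)

  ↾-preimage : {X Y Z W : Set} (f : X → Z) (g : Y → W) (R : REL Z W 0ℓ)
               {h : Z → Q} {y : Y} →
               (preimage f g R ↾ (h ∘ f)) y ≤ (R ↾ h) (g y)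
  ↾-preimage f g R = ↾-least (preimage f g R) (↾-upper R)

  Graph : {X Z : Set} → (X → Z) → REL X Z 0ℓ
  Graph f x z = f x ≡ z

  ≤-↾-Graph : {X Z : Set} (f : X → Z) {h : X → Q} (x : X) →
              h x ≤ (Graph f ↾ h) (f x)
  ≤-↾-Graph f x = ↾-upper (Graph f) refl

  ↾-Graph-preimage : {X Y Z W : Set} (f : X → Z) (g : Y → W) (R : REL Z W 0ℓ)
                     {h : X → Q} {y : Y} →
                     (R ↾ (Graph f ↾ h)) (g y) ≤ (preimage f g R ↾ h) y
  ↾-Graph-preimage f g R = ↾-least R λ zRgy → ↾-least (Graph f) λ fx≡z →
    ↾-upper (preimage f g R) (subst (λ z → R z _) (sym fx≡z) zRgy)

  module Properties {I : Set} (mods : I → Modality) (leafMono : ∀ q → LeafMonotone (mods q)) where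

    ∈-mono : {X : Set} (q : I) {h₁ h₂ : X → Q} → (∀ x → h₁ x ≤ h₂ x) →
             (t : T X) → (t ∈ mods q ⟨ h₁ ⟩) ≤ (t ∈ mods q ⟨ h₂ ⟩)
    ∈-mono q h₁≤h₂ t = leafMono q (mapLabel-mono h₁≤h₂ ∘ proj₁ t)

    *-∈ : {X Y : Set} (q : I) (f : X → Y) (h : Y → Q) (t : T X) →
          ((f *) t ∈ mods q ⟨ h ⟩) ≤ (t ∈ mods q ⟨ h ∘ f ⟩)
    *-∈ q f h t = leafMono q (LabelLeq-reflexive ∘ mapLabel-∘ f h ∘ proj₁ t)

    ∈-* : {X Y : Set} (q : I) (f : X → Y) (h : Y → Q) (t : T X) →
          (t ∈ mods q ⟨ h ∘ f ⟩) ≤ ((f *) t ∈ mods q ⟨ h ⟩)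
    ∈-* q f h t = leafMono q (LabelLeq-reflexive ∘ sym ∘ mapLabel-∘ f h ∘ proj₁ t)

    Rel𝒬-≤ : {X Y : Set} (R : REL X Y 0ℓ) {t : T X} {r : T Y} →
             Rel𝒬 mods R t r → (q : I) {h : X → Q} {k : Y → Q} →
             (∀ y → (R ↾ h) y ≤ k y) → (t ∈ mods q ⟨ h ⟩) ≤ (r ∈ mods q ⟨ k ⟩)
    Rel𝒬-≤ R {r = r} tRr q {h} R↾h≤k = ≤-trans (tRr q h) (∈-mono q R↾h≤k r)

    Rel𝒬-reflexive : {X : Set} (R : REL X X 0ℓ) → Reflexive R → Reflexive (Rel𝒬 mods R)
    Rel𝒬-reflexive R refl-R {t} q h = ∈-mono q (λ x → ↾-upper R refl-R) t

    Rel𝒬-mono : {X Y : Set} (R S : REL X Y 0ℓ) → R ⇒ S → Rel𝒬 mods R ⇒ Rel𝒬 mods S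
    Rel𝒬-mono R S R⇒S {t} {r} tRr q h = Rel𝒬-≤ R {t} {r} tRr q (λ y → ↾-mono R S R⇒S)

    Rel𝒬-⨾ : {X Y Z : Set} (R : REL X Y 0ℓ) (S : REL Y Z 0ℓ) →
             (Rel𝒬 mods R ⨾ Rel𝒬 mods S) ⇒ Rel𝒬 mods (R ⨾ S)
    Rel𝒬-⨾ R S {t} {r} (s , tRs , sSr) q h =
      ≤-trans (tRs q h) (Rel𝒬-≤ S {s} {r} sSr q (λ z → ↾-⨾ R S))

    Rel𝒬-preimage⇒ : {X Y Z W : Set} (f : X → Z) (g : Y → W) (R : REL Z W 0ℓ) →
                     Rel𝒬 mods (preimage f g R) ⇒ preimage (f *) (g *) (Rel𝒬 mods R)
    Rel𝒬-preimage⇒ f g R {t} {r} tRr q h = begin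
      (f *) t ∈ mods q ⟨ h ⟩       ≤⟨ *-∈ q f h t ⟩
      t ∈ mods q ⟨ h ∘ f ⟩         ≤⟨ Rel𝒬-≤ (preimage f g R) {t} {r} tRr q (λ y → ↾-preimage f g R) ⟩
      r ∈ mods q ⟨ (R ↾ h) ∘ g ⟩   ≤⟨ ∈-* q g (R ↾ h) r ⟩
      (g *) r ∈ mods q ⟨ R ↾ h ⟩   ∎

    Rel𝒬-preimage⇐ : {X Y Z W : Set} (f : X → Z) (g : Y → W) (R : REL Z W 0ℓ) →
                     preimage (f *) (g *) (Rel𝒬 mods R) ⇒ Rel𝒬 mods (preimage f g R)
    Rel𝒬-preimage⇐ {Z = Z} f g R {t} {r} f*tRg*r q h = begin
      t ∈ mods q ⟨ h ⟩                   ≤⟨ ∈-mono q (≤-↾-Graph f) t ⟩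
      t ∈ mods q ⟨ image ∘ f ⟩           ≤⟨ ∈-* q f image t ⟩
      (f *) t ∈ mods q ⟨ image ⟩         ≤⟨ f*tRg*r q image ⟩
      (g *) r ∈ mods q ⟨ R ↾ image ⟩     ≤⟨ *-∈ q g (R ↾ image) r ⟩
      r ∈ mods q ⟨ (R ↾ image) ∘ g ⟩     ≤⟨ ∈-mono q (λ y → ↾-Graph-preimage f g R) r ⟩
      r ∈ mods q ⟨ preimage f g R ↾ h ⟩  ∎
      where
        image : Z → Q
        image = Graph f ↾ h

lemma17 : {ℓ : Level} (Sig : Signature) (L : CompleteLattice ℓ) →
    let open Relator Sig L in
    {I : Set} (mods : I → Modality) → (∀ q → LeafMonotone (mods q)) →
    (∀ {X : Set} (R : REL X X 0ℓ) → Reflexive R → Reflexive (Rel𝒬 mods R))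
    × (∀ {X Y : Set} (R S : REL X Y 0ℓ) → R ⇒ S → Rel𝒬 mods R ⇒ Rel𝒬 mods S)
    × (∀ {X Y Z : Set} (R : REL X Y 0ℓ) (S : REL Y Z 0ℓ) →
         (Rel𝒬 mods R ⨾ Rel𝒬 mods S) ⇒ Rel𝒬 mods (R ⨾ S))
    × (∀ {X Y Z W : Set} (f : X → Z) (g : Y → W) (R : REL Z W 0ℓ) →
         (Rel𝒬 mods (preimage f g R) ⇒ preimage (f *) (g *) (Rel𝒬 mods R))
         × (preimage (f *) (g *) (Rel𝒬 mods R) ⇒ Rel𝒬 mods (preimage f g R)))
lemma17 Sig L mods leafMono =
    (λ R refl-R {t} → Rel𝒬-reflexive R refl-R {t})
  , (λ R S R⇒S {t} {r} → Rel𝒬-mono R S R⇒S {t} {r})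
  , (λ R S {t} {r} → Rel𝒬-⨾ R S {t} {r})
  , λ f g R → (λ {t} {r} → Rel𝒬-preimage⇒ f g R {t} {r})
            , (λ {t} {r} → Rel𝒬-preimage⇐ f g R {t} {r})
  where open LeafMonotoneRelator.Properties Sig L mods leafMono
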